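{- Let $a=(a_1,\dots,a_n)$ be a sequence of positive integers, let $I$ be a subset of $\{1,2,\dots,n\}$ with at least two elements, and let $i\in I$. Then \[ \sum_{\emptyset\neq J\subseteq I\setminus\{i\}}(-1)^{|J|}\,q^{L_{I\setminus\{i\},J}(a^{(i)})+a_J} =-\,q^{L_{I,\{i\}}(a)-\sum_{j=i+1}^n a_j}. \]
   Context: $q$ is an indeterminate; $|J|$ is the number of elements of $J$ and $a_S:=\sum_{j\in S}a_j$. For $I,J\subseteq\{1,\dots,n\}$, $L_{I,J}(a):=\sum_{1\le u\le v\le n,\ u\in I,\ v\notin J} a_v$. The sequence $a^{(i)}$ is $a$ with the entry $a_i$ deleted, its entries keeping their original indices in $\{1,\dots,n\}\setminus\{i\}$; accordingly, for $I',J'\subseteq\{1,\dots,n\}\setminus\{i\}$, $L_{I',J'}(a^{(i)}):=\sum a_v$ over pairs $u\le v$ with $u,v\ne i$, $u\in I'$, $v\notin J'$. -}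

module Defs where

open import Level using (Level)
open import Data.Bool using (Bool; true; false; if_then_else_; _∧_; not)
open import Data.Nat using (ℕ; zero; suc; _≤?_; _<?_)
open import Data.Nat.ListAction using (sum)
open import Data.Fin using (Fin; toℕ; _≟_)
open import Data.List using (List; []; _∷_; [_]; map; _++_; allFin)
open import Data.Vec using (_∷_; [])
open import Data.Fin.Subset using (Subset; inside; outside)
open import Data.Fin.Subset.Properties using (_∈?_)
open import Relation.Nullary using (does)
open import Algebra.Bundles using (CommutativeRing)

sumFin : ∀ {n} → (Fin n → ℕ) → ℕ
sumFin {n} f = sum (map f (allFin n))

L : ∀ {n} → Subset n → Subset n → (Fin n → ℕ) → ℕ
L I J a = sumFin λ u → sumFin λ v →
  if does (u ∈? I) ∧ does (toℕ u ≤? toℕ v) ∧ not (does (v ∈? J)) then a v else 0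

-- L_{I',J'}(a^{(i)}) : same sum but over pairs u ≤ v with u ≠ i and v ≠ i
-- (the entries of a^{(i)} keep their original indices)
Ldel : ∀ {n} → Fin n → Subset n → Subset n → (Fin n → ℕ) → ℕ
Ldel i I J a = sumFin λ u → sumFin λ v →
  if not (does (u ≟ i)) ∧ not (does (v ≟ i))
     ∧ does (u ∈? I) ∧ does (toℕ u ≤? toℕ v) ∧ not (does (v ∈? J))
  then a v else 0

aS : ∀ {n} → Subset n → (Fin n → ℕ) → ℕ
aS J a = sumFin λ j → if does (j ∈? J) then a j else 0

tailSum : ∀ {n} → Fin n → (Fin n → ℕ) → ℕ
tailSum i a = sumFin λ j → if does (toℕ i <? toℕ j) then a j else 0

allSubsets : ∀ n → List (Subset n)
allSubsets zero = [ [] ]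
allSubsets (suc n) = map (inside ∷_) (allSubsets n) ++ map (outside ∷_) (allSubsets n)

module _ {c ℓ : Level} (R : CommutativeRing c ℓ) where
  open CommutativeRing R

  pow : Carrier → ℕ → Carrier
  pow x zero = 1#
  pow x (suc k) = x * pow x k

  ringSum : List Carrier → Carrier
  ringSum [] = 0#
  ringSum (x ∷ xs) = x + ringSum xs

module Submission where

-- Write I' = I - i and, for J ⊆ I', E(J) = L_{I',J}(a^{(i)}) + a_J, so that the
-- left-hand side is the sum of (-1)^|J| q^E(J) over the nonempty J ⊆ I'.
-- Since |I| ≥ 2, I' has a least element m (and m ≠ i).  Adding m to a set
-- J ∌ m leaves E unchanged: a_J gains a_m, while L loses exactly the entry
-- (u,v) = (m,m), because m is the only u ∈ I' with u ≤ m.  Hence J ↦ J ∪ {m}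
-- pairs the subsets of I' into pairs of opposite terms, and the sum over ALL
-- J ⊆ I' vanishes.

open import Defs
open import Level using (Level)
open import Function using (_∘_; mk⇔)
open import Data.Bool using (Bool; true; false; _∧_; not; if_then_else_)
open import Data.Bool.Properties using (∧-zeroʳ; ∧-identityʳ; ∧-comm; ∧-assoc)
open import Data.Nat using (ℕ; zero; suc; _≤_; _∸_; _≤?_; _<?_; z≤n; s≤s) renaming (_+_ to _+ℕ_)
import Data.Nat.Properties as ℕₚ
open import Data.Fin using (Fin; zero; suc; toℕ; _≟_; punchIn)
open import Data.Fin.Properties using (toℕ-injective; punchInᵢ≢i)
open import Data.List using (List; []; _∷_; map; filter; _++_; tabulate; allFin)
open import Data.Nat.ListAction using (sum)
open import Data.List.Properties using (map-cong; map-tabulate; map-++; map-∘)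
open import Data.Vec using (_∷_; here; there)
open import Data.Vec.Functional using (removeAt)
open import Data.Fin.Subset using (Subset; inside; outside; _∈_; _∉_; _⊆_; _-_; _─_; _∪_; ⁅_⁆; ⊥; ∣_∣; Nonempty)
open import Data.Fin.Subset.Properties using (_∈?_; _⊆?_; nonempty?; ∉⊥; ⊥⊆; drop-there; x∈⁅x⁆; x∈⁅y⁆⇒x≡y; x∈⁅y⁆⇔x≡y; x∉⁅y⁆⇒x≢y; ∣⁅x⁆∣≡1; ∣⊥∣≡0; p⊆q⇒∣p∣≤∣q∣; p─q⊆p; x∈p∧x∉q⇒x∈p─q; x∈p∧x≢y⇒x∈p-y; p⊆p∪q; x∈p∪q⁺; x∈p∪q⁻; ∪-identityʳ)
open import Data.Product using (Σ; _×_; _,_)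
open import Data.Sum using (inj₁; inj₂)
open import Data.Empty using (⊥-elim)
open import Relation.Nullary using (Dec; yes; no; does; ¬_)
open import Relation.Nullary.Decidable using (_×-dec_; ¬?; dec-true; dec-false; does-⇔)
open import Relation.Binary.PropositionalEquality as ≡ using (_≡_; _≢_; refl; cong; cong₂; _≗_; module ≡-Reasoning)
open import Algebra.Bundles using (CommutativeRing)
import Algebra.Properties.CommutativeMonoid.Sum as MonoidSum
import Algebra.Properties.Ring as RingProperties
import Algebra.Properties.Group as GroupProperties
import Relation.Binary.Reasoning.Setoid as SetoidReasoning

-- Finite sums over Fin n with values in ℕ

module ∑ℕ = MonoidSum ℕₚ.+-0-commutativeMonoid

sumFin≡∑ : ∀ {n} (f : Fin n → ℕ) → sumFin f ≡ ∑ℕ.sum f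
sumFin≡∑ {zero} f = refl
sumFin≡∑ {suc n} f = cong (f zero +ℕ_) (begin
  sum (map f (tabulate suc))  ≡⟨ cong sum (map-tabulate suc f) ⟩
  sum (tabulate (f ∘ suc))    ≡⟨ cong sum (≡.sym (map-tabulate (λ x → x) (f ∘ suc))) ⟩
  sumFin (f ∘ suc)            ≡⟨ sumFin≡∑ (f ∘ suc) ⟩
  ∑ℕ.sum (f ∘ suc)            ∎)
  where open ≡-Reasoning

sumFin-cong : ∀ {n} {f g : Fin n → ℕ} → f ≗ g → sumFin f ≡ sumFin g
sumFin-cong {n} f≗g = cong sum (map-cong f≗g (allFin n))

sumFin-zero : ∀ {n} {f : Fin n → ℕ} → (∀ x → f x ≡ 0) → sumFin f ≡ 0
sumFin-zero {n} f≡0 = ≡.trans (sumFin-cong f≡0) (≡.trans (sumFin≡∑ {n} (λ _ → 0)) (∑ℕ.sum-replicate-zero n))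

sumFin-+ : ∀ {n} (f g : Fin n → ℕ) → sumFin (λ x → f x +ℕ g x) ≡ sumFin f +ℕ sumFin g
sumFin-+ {n} f g = begin
  sumFin (λ x → f x +ℕ g x)  ≡⟨ sumFin≡∑ {n} _ ⟩
  ∑ℕ.sum (λ x → f x +ℕ g x)  ≡⟨ ∑ℕ.∑-distrib-+ f g ⟩
  ∑ℕ.sum f +ℕ ∑ℕ.sum g       ≡⟨ cong₂ _+ℕ_ (sumFin≡∑ f) (sumFin≡∑ g) ⟨
  sumFin f +ℕ sumFin g       ∎
  where open ≡-Reasoning

sumFin-extract : ∀ {n} {f g : Fin n → ℕ} (m : Fin n) → (∀ x → x ≢ m → f x ≡ g x) → g m ≡ 0
               → sumFin f ≡ sumFin g +ℕ f m
sumFin-extract {suc n} {f} {g} m agree gm≡0 = begin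
  sumFin f              ≡⟨ ≡.trans (sumFin≡∑ f) (∑ℕ.sum-remove f) ⟩
  f m +ℕ rest f         ≡⟨ cong (f m +ℕ_) (∑ℕ.sum-cong-≗ λ j → agree (punchIn m j) (punchInᵢ≢i m j)) ⟩
  f m +ℕ rest g         ≡⟨ ℕₚ.+-comm (f m) (rest g) ⟩
  rest g +ℕ f m         ≡⟨ cong (_+ℕ f m) sumFin-g ⟨
  sumFin g +ℕ f m       ∎
  where
  open ≡-Reasoning
  rest : (Fin (suc n) → ℕ) → ℕ
  rest h = ∑ℕ.sum (removeAt h m)
  sumFin-g : sumFin g ≡ rest g
  sumFin-g = ≡.trans (sumFin≡∑ g) (≡.trans (∑ℕ.sum-remove g) (cong (_+ℕ rest g) gm≡0))

sumFin-single : ∀ {n} {f : Fin n → ℕ} (m : Fin n) → (∀ x → x ≢ m → f x ≡ 0) → sumFin f ≡ f m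
sumFin-single {n} m off = ≡.trans (sumFin-extract {g = λ _ → 0} m off refl)
                                  (cong (_+ℕ _) (sumFin-zero {n} λ _ → refl))

x∈p─q⇒x∉q : ∀ {n} {x : Fin n} (p q : Subset n) → x ∈ p ─ q → x ∉ q
x∈p─q⇒x∉q (s ∷ p) (outside ∷ q) (there x∈p─q) (there x∈q) = x∈p─q⇒x∉q p q x∈p─q x∈q
x∈p─q⇒x∉q (s ∷ p) (inside  ∷ q) (there x∈p─q) (there x∈q) = x∈p─q⇒x∉q p q x∈p─q x∈q

x∈p-y⇒x≢y : ∀ {n} {x y : Fin n} (p : Subset n) → x ∈ p - y → x ≢ y
x∈p-y⇒x≢y {y = y} p = x∉⁅y⁆⇒x≢y ∘ x∈p─q⇒x∉q p ⁅ y ⁆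

does-∈─ : ∀ {n} (x : Fin n) (p q : Subset n) → does (x ∈? p ─ q) ≡ does (x ∈? p) ∧ not (does (x ∈? q))
does-∈─ x p q = does-⇔ (mk⇔ (λ x∈ → p─q⊆p p q x∈ , x∈p─q⇒x∉q p q x∈) (λ (x∈p , x∉q) → x∈p∧x∉q⇒x∈p─q x∈p x∉q))
                       (x ∈? p ─ q) (x ∈? p ×-dec ¬? (x ∈? q))

does-∈⁅⁆ : ∀ {n} (x y : Fin n) → does (x ∈? ⁅ y ⁆) ≡ does (x ≟ y)
does-∈⁅⁆ x y = does-⇔ x∈⁅y⁆⇔x≡y (x ∈? ⁅ y ⁆) (x ≟ y)

does-∈- : ∀ {n} (x : Fin n) (p : Subset n) (y : Fin n) → does (x ∈? p - y) ≡ does (x ∈? p) ∧ not (does (x ≟ y))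
does-∈- x p y = ≡.trans (does-∈─ x p ⁅ y ⁆) (cong (λ b → does (x ∈? p) ∧ not b) (does-∈⁅⁆ x y))

does-∈⊥ : ∀ {n} (x : Fin n) → does (x ∈? ⊥) ≡ false
does-∈⊥ x = dec-false (x ∈? ⊥) ∉⊥

does-∈-∪⁅⁆ : ∀ {n} {x m : Fin n} (J : Subset n) → x ≢ m → does (x ∈? J ∪ ⁅ m ⁆) ≡ does (x ∈? J)
does-∈-∪⁅⁆ {x = x} {m} J x≢m = does-⇔ (mk⇔ to (p⊆p∪q ⁅ m ⁆)) (x ∈? J ∪ ⁅ m ⁆) (x ∈? J)
  where
  to : x ∈ J ∪ ⁅ m ⁆ → x ∈ J
  to x∈ with x∈p∪q⁻ J ⁅ m ⁆ x∈
  ... | inj₁ x∈J = x∈J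
  ... | inj₂ x∈⁅m⁆ = ⊥-elim (x≢m (x∈⁅y⁆⇒x≡y m x∈⁅m⁆))

m∈J∪⁅m⁆ : ∀ {n} (m : Fin n) (J : Subset n) → m ∈ J ∪ ⁅ m ⁆
m∈J∪⁅m⁆ m J = x∈p∪q⁺ (inj₂ (x∈⁅x⁆ m))

∣J∪⁅m⁆∣ : ∀ {n} (m : Fin n) (J : Subset n) → m ∉ J → ∣ J ∪ ⁅ m ⁆ ∣ ≡ suc ∣ J ∣
∣J∪⁅m⁆∣ zero    (outside ∷ J) m∉J = cong (suc ∘ ∣_∣) (∪-identityʳ J)
∣J∪⁅m⁆∣ zero    (inside  ∷ J) m∉J = ⊥-elim (m∉J here)
∣J∪⁅m⁆∣ (suc m) (outside ∷ J) m∉J = ∣J∪⁅m⁆∣ m J (m∉J ∘ there)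
∣J∪⁅m⁆∣ (suc m) (inside  ∷ J) m∉J = cong suc (∣J∪⁅m⁆∣ m J (m∉J ∘ there))

does-∪⁅⁆⊆ : ∀ {n} {m : Fin n} {I' : Subset n} (J : Subset n) → m ∈ I' → does (J ∪ ⁅ m ⁆ ⊆? I') ≡ does (J ⊆? I')
does-∪⁅⁆⊆ {m = m} {I'} J m∈I' = does-⇔ (mk⇔ (λ J∪m⊆I' {x} x∈J → J∪m⊆I' (p⊆p∪q ⁅ m ⁆ x∈J)) from) (J ∪ ⁅ m ⁆ ⊆? I') (J ⊆? I')
  where
  from : J ⊆ I' → J ∪ ⁅ m ⁆ ⊆ I'
  from J⊆I' x∈ with x∈p∪q⁻ J ⁅ m ⁆ x∈
  ... | inj₁ x∈J = J⊆I' x∈J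
  ... | inj₂ x∈⁅m⁆ = ≡.subst (_∈ I') (≡.sym (x∈⁅y⁆⇒x≡y m x∈⁅m⁆)) m∈I'

does-nonempty-inside : ∀ {n} (J : Subset n) → does (nonempty? (inside ∷ J)) ≡ true
does-nonempty-inside J = dec-true (nonempty? (inside ∷ J)) (zero , here)

does-nonempty-outside : ∀ {n} (J : Subset n) → does (nonempty? (outside ∷ J)) ≡ does (nonempty? J)
does-nonempty-outside J = does-⇔ (mk⇔ (λ { (suc x , there x∈J) → x , x∈J }) (λ (x , x∈J) → suc x , there x∈J))
                                 (nonempty? (outside ∷ J)) (nonempty? J)

least : ∀ {n} (p : Subset n) → Nonempty p → Σ (Fin n) λ m → m ∈ p × (∀ u → u ∈ p → toℕ m ≤ toℕ u)
least (inside ∷ p)  _                    = zero , here , λ _ _ → z≤n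
least (outside ∷ p) (suc x , there x∈p) with least p (x , x∈p)
... | m , m∈p , m-least = suc m , there m∈p , λ { (suc u) (there u∈p) → s≤s (m-least u u∈p) }

nonempty-minus : ∀ {n} (I : Subset n) (i : Fin n) → 2 ≤ ∣ I ∣ → Nonempty (I - i)
nonempty-minus I i 2≤∣I∣ with nonempty? (I - i)
... | yes ne = ne
... | no empty = ⊥-elim (2≰1 (ℕₚ.≤-trans 2≤∣I∣ (≡.subst (∣ I ∣ ≤_) (∣⁅x⁆∣≡1 i) (p⊆q⇒∣p∣≤∣q∣ I⊆⁅i⁆))))
  where
  2≰1 : ¬ (2 ≤ 1)
  2≰1 (s≤s ())
  I⊆⁅i⁆ : I ⊆ ⁅ i ⁆
  I⊆⁅i⁆ {x} x∈I with x ≟ i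
  ... | yes refl = x∈⁅x⁆ x
  ... | no x≢i = ⊥-elim (empty (x , x∈p∧x≢y⇒x∈p-y x∈I x≢i))

-- The exponent E(J) = L_{I',J}(a^{(i)}) + a_J

module Exponent {n} (a : Fin n → ℕ) (i : Fin n) (I' : Subset n) where

  counted : Fin n → Fin n → Bool → Bool
  counted u v v∉J = not (does (u ≟ i)) ∧ not (does (v ≟ i)) ∧ does (u ∈? I') ∧ does (toℕ u ≤? toℕ v) ∧ v∉J

  entry : Subset n → Fin n → Fin n → ℕ
  entry J u v = if counted u v (not (does (v ∈? J))) then a v else 0

  exponent : Subset n → ℕ
  exponent J = Ldel i I' J a +ℕ aS J a

  entry-cong : ∀ {J K} u v → does (v ∈? J) ≡ does (v ∈? K) → entry J u v ≡ entry K u v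
  entry-cong u v = cong (λ b → if counted u v (not b) then a v else 0)

  entry-∈ : ∀ {J} u v → v ∈ J → entry J u v ≡ 0
  entry-∈ {J} u v v∈J rewrite dec-true (v ∈? J) v∈J
                            | ∧-zeroʳ (does (toℕ u ≤? toℕ v)) | ∧-zeroʳ (does (u ∈? I'))
                            | ∧-zeroʳ (not (does (v ≟ i))) | ∧-zeroʳ (not (does (u ≟ i))) = refl

  entry-row-i : ∀ J v → entry J i v ≡ 0
  entry-row-i J v rewrite dec-true (i ≟ i) refl = refl

  aS-∪⁅⁆ : ∀ {m} J → m ∉ J → aS (J ∪ ⁅ m ⁆) a ≡ aS J a +ℕ a m
  aS-∪⁅⁆ {m} J m∉J = begin
    aS (J ∪ ⁅ m ⁆) a                         ≡⟨ sumFin-extract m (λ x x≢m → cong (weight x) (does-∈-∪⁅⁆ J x≢m))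
                                                               (cong (weight m) (dec-false (m ∈? J) m∉J)) ⟩
    aS J a +ℕ weight m (does (m ∈? J ∪ ⁅ m ⁆)) ≡⟨ cong (λ b → aS J a +ℕ weight m b) (dec-true (m ∈? J ∪ ⁅ m ⁆) (m∈J∪⁅m⁆ m J)) ⟩
    aS J a +ℕ a m                             ∎
    where
    open ≡-Reasoning
    weight : Fin n → Bool → ℕ
    weight x b = if b then a x else 0

  module LeastElement (m : Fin n) (m∈I' : m ∈ I') (m≢i : m ≢ i) (m-least : ∀ u → u ∈ I' → toℕ m ≤ toℕ u) where

    -- Only the row u = m meets the column of m, since no u ∈ I' lies below m.
    column-off : ∀ J u → u ≢ m → entry J u m ≡ 0
    column-off J u u≢m with u ≟ i | m ≟ i | u ∈? I'
    ... | yes _ | _     | _        = refl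
    ... | no _  | yes _ | _        = refl
    ... | no _  | no _  | no _     = refl
    ... | no _  | no _  | yes u∈I' =
      cong (λ b → if b ∧ not (does (m ∈? J)) then a m else 0) (dec-false (toℕ u ≤? toℕ m) u≰m)
      where
      u≰m : ¬ toℕ u ≤ toℕ m
      u≰m u≤m = u≢m (toℕ-injective (ℕₚ.≤-antisym u≤m (m-least u u∈I')))

    column-diag : ∀ J → m ∉ J → entry J m m ≡ a m
    column-diag J m∉J rewrite dec-false (m ≟ i) m≢i | dec-true (m ∈? I') m∈I' | dec-false (m ∈? J) m∉J =
      cong (λ b → if b ∧ true then a m else 0) (dec-true (toℕ m ≤? toℕ m) ℕₚ.≤-refl)

    Ldel-∪⁅m⁆ : ∀ J → m ∉ J → Ldel i I' J a ≡ Ldel i I' (J ∪ ⁅ m ⁆) a +ℕ a m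
    Ldel-∪⁅m⁆ J m∉J = begin
      sumFin (λ u → sumFin (entry J u))                          ≡⟨ sumFin-cong row ⟩
      sumFin (λ u → sumFin (entry K u) +ℕ entry J u m)           ≡⟨ sumFin-+ (sumFin ∘ entry K) (λ u → entry J u m) ⟩
      Ldel i I' K a +ℕ sumFin (λ u → entry J u m)                ≡⟨ cong (Ldel i I' K a +ℕ_) column ⟩
      Ldel i I' K a +ℕ a m                                       ∎
      where
      open ≡-Reasoning
      K = J ∪ ⁅ m ⁆
      row : ∀ u → sumFin (entry J u) ≡ sumFin (entry K u) +ℕ entry J u m
      row u = sumFin-extract m (λ v v≢m → entry-cong u v (≡.sym (does-∈-∪⁅⁆ J v≢m))) (entry-∈ u m (m∈J∪⁅m⁆ m J))
      column : sumFin (λ u → entry J u m) ≡ a m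
      column = ≡.trans (sumFin-single m (column-off J)) (column-diag J m∉J)

    exponent-∪⁅m⁆ : ∀ J → m ∉ J → exponent (J ∪ ⁅ m ⁆) ≡ exponent J
    exponent-∪⁅m⁆ J m∉J = begin
      Ldel i I' K a +ℕ aS K a            ≡⟨ cong (Ldel i I' K a +ℕ_) (aS-∪⁅⁆ J m∉J) ⟩
      Ldel i I' K a +ℕ (aS J a +ℕ a m)   ≡⟨ cong (Ldel i I' K a +ℕ_) (ℕₚ.+-comm (aS J a) (a m)) ⟩
      Ldel i I' K a +ℕ (a m +ℕ aS J a)   ≡⟨ ℕₚ.+-assoc (Ldel i I' K a) (a m) (aS J a) ⟨
      (Ldel i I' K a +ℕ a m) +ℕ aS J a   ≡⟨ cong (_+ℕ aS J a) (Ldel-∪⁅m⁆ J m∉J) ⟨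
      Ldel i I' J a +ℕ aS J a            ∎
      where
      open ≡-Reasoning
      K = J ∪ ⁅ m ⁆

module EmptyExponent {n} (a : Fin n → ℕ) (i : Fin n) (I : Subset n) (i∈I : i ∈ I) where
  open Exponent a i (I - i)

  entryL : Fin n → Fin n → ℕ
  entryL u v = if does (u ∈? I) ∧ does (toℕ u ≤? toℕ v) ∧ not (does (v ∈? ⁅ i ⁆)) then a v else 0

  -- The condition of Ldel for u ≠ i and J = ∅, rearranged into that of L.
  reorder : ∀ x y z → x ∧ (y ∧ true) ∧ z ∧ true ≡ y ∧ z ∧ x
  reorder x y z rewrite ∧-identityʳ y | ∧-identityʳ z = ≡.trans (∧-comm x (y ∧ z)) (∧-assoc y z x)

  row-agree : ∀ u → u ≢ i → sumFin (entryL u) ≡ sumFin (entry ⊥ u)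
  row-agree u u≢i = sumFin-cong λ v → cong (λ b → if b then a v else 0) (≡.sym (same-condition v))
    where
    same-condition : ∀ v → counted u v (not (does (v ∈? ⊥)))
                         ≡ does (u ∈? I) ∧ does (toℕ u ≤? toℕ v) ∧ not (does (v ∈? ⁅ i ⁆))
    same-condition v rewrite does-∈- u I i | dec-false (u ≟ i) u≢i | does-∈⊥ v | does-∈⁅⁆ v i =
      reorder (not (does (v ≟ i))) (does (u ∈? I)) (does (toℕ u ≤? toℕ v))

  row-i : sumFin (entryL i) ≡ tailSum i a
  row-i = sumFin-cong λ v → ≡.trans (cong₂ (λ b c → if b ∧ does (toℕ i ≤? toℕ v) ∧ not c then a v else 0)
                                           (dec-true (i ∈? I) i∈I) (does-∈⁅⁆ v i))
                                    (cong (λ b → if b then a v else 0) (strictly-after v))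
    where
    strictly-after : ∀ v → does (toℕ i ≤? toℕ v) ∧ not (does (v ≟ i)) ≡ does (toℕ i <? toℕ v)
    strictly-after v = does-⇔
      (mk⇔ (λ (i≤v , v≢i) → ℕₚ.≤∧≢⇒< i≤v (v≢i ∘ ≡.sym ∘ toℕ-injective))
           (λ i<v → ℕₚ.<⇒≤ i<v , λ v≡i → ℕₚ.<-irrefl (cong toℕ (≡.sym v≡i)) i<v))
      (toℕ i ≤? toℕ v ×-dec ¬? (v ≟ i)) (toℕ i <? toℕ v)

  -- Ldel for J = ∅ is L with row i (which sums to tailSum i a) removed.
  Ldel-⊥ : Ldel i (I - i) ⊥ a +ℕ tailSum i a ≡ L I ⁅ i ⁆ a
  Ldel-⊥ = ≡.sym (begin
    sumFin (sumFin ∘ entryL)                            ≡⟨ sumFin-extract i row-agree (sumFin-zero (entry-row-i ⊥)) ⟩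
    sumFin (sumFin ∘ entry ⊥) +ℕ sumFin (entryL i)      ≡⟨ cong (Ldel i (I - i) ⊥ a +ℕ_) row-i ⟩
    Ldel i (I - i) ⊥ a +ℕ tailSum i a                   ∎)
    where open ≡-Reasoning

  exponent-⊥ : exponent ⊥ ≡ L I ⁅ i ⁆ a ∸ tailSum i a
  exponent-⊥ = begin
    Ldel i (I - i) ⊥ a +ℕ aS ⊥ a                 ≡⟨ cong (Ldel i (I - i) ⊥ a +ℕ_) (sumFin-zero λ j → cong (λ b → if b then a j else 0) (does-∈⊥ j)) ⟩
    Ldel i (I - i) ⊥ a +ℕ 0                      ≡⟨ ℕₚ.+-identityʳ _ ⟩
    Ldel i (I - i) ⊥ a                           ≡⟨ ℕₚ.m+n∸n≡m _ (tailSum i a) ⟨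
    (Ldel i (I - i) ⊥ a +ℕ tailSum i a) ∸ tailSum i a ≡⟨ cong (_∸ tailSum i a) Ldel-⊥ ⟩
    L I ⁅ i ⁆ a ∸ tailSum i a                    ∎
    where open ≡-Reasoning

-- Sums over all subsets in a commutative ring

module SubsetSums {c ℓ : Level} (R : CommutativeRing c ℓ) where
  open CommutativeRing R hiding (_-_) renaming (refl to ≈-refl)
  open SetoidReasoning setoid

  ∑ : List Carrier → Carrier
  ∑ = ringSum R

  ∑-++ : ∀ xs ys → ∑ (xs ++ ys) ≈ ∑ xs + ∑ ys
  ∑-++ []       ys = sym (+-identityˡ _)
  ∑-++ (x ∷ xs) ys = trans (+-congˡ (∑-++ xs ys)) (sym (+-assoc _ _ _))

  ∑-map-+ : ∀ {A : Set} (f g : A → Carrier) xs → ∑ (map (λ x → f x + g x) xs) ≈ ∑ (map f xs) + ∑ (map g xs)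
  ∑-map-+ f g []       = sym (+-identityˡ _)
  ∑-map-+ f g (x ∷ xs) = begin
    (f x + g x) + ∑ (map (λ x → f x + g x) xs)   ≈⟨ +-congˡ (∑-map-+ f g xs) ⟩
    (f x + g x) + (∑ (map f xs) + ∑ (map g xs))  ≈⟨ +-assoc _ _ _ ⟩
    f x + (g x + (∑ (map f xs) + ∑ (map g xs)))  ≈⟨ +-congˡ (x+[y+z]≈y+[x+z] (g x) _ _) ⟩
    f x + (∑ (map f xs) + (g x + ∑ (map g xs)))  ≈⟨ +-assoc _ _ _ ⟨
    (f x + ∑ (map f xs)) + (g x + ∑ (map g xs))  ∎
    where
    x+[y+z]≈y+[x+z] : ∀ x y z → x + (y + z) ≈ y + (x + z)
    x+[y+z]≈y+[x+z] x y z = trans (sym (+-assoc x y z)) (trans (+-congʳ (+-comm x y)) (+-assoc y x z))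

  ∑-map-0 : ∀ {A : Set} {f : A → Carrier} (xs : List A) → (∀ x → f x ≈ 0#) → ∑ (map f xs) ≈ 0#
  ∑-map-0 []       f≈0 = ≈-refl
  ∑-map-0 (x ∷ xs) f≈0 = trans (+-cong (f≈0 x) (∑-map-0 xs f≈0)) (+-identityˡ 0#)

  ∑-filter : ∀ {A : Set} {P : A → Set} (P? : ∀ x → Dec (P x)) (f : A → Carrier) xs
           → ∑ (map f (filter P? xs)) ≈ ∑ (map (λ x → if does (P? x) then f x else 0#) xs)
  ∑-filter P? f []       = ≈-refl
  ∑-filter P? f (x ∷ xs) with does (P? x)
  ... | true  = +-congˡ (∑-filter P? f xs)
  ... | false = trans (∑-filter P? f xs) (sym (+-identityˡ _))

  subsetSum : ∀ {n} → (Subset n → Carrier) → Carrier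
  subsetSum {n} G = ∑ (map G (allSubsets n))

  subsetSum-∷ : ∀ {n} (G : Subset (suc n) → Carrier)
              → subsetSum G ≈ subsetSum (G ∘ (inside ∷_)) + subsetSum (G ∘ (outside ∷_))
  subsetSum-∷ {n} G = begin
    ∑ (map G (map (inside ∷_) S ++ map (outside ∷_) S))        ≡⟨ cong ∑ (map-++ G (map (inside ∷_) S) (map (outside ∷_) S)) ⟩
    ∑ (map G (map (inside ∷_) S) ++ map G (map (outside ∷_) S)) ≈⟨ ∑-++ (map G (map (inside ∷_) S)) _ ⟩
    ∑ (map G (map (inside ∷_) S)) + ∑ (map G (map (outside ∷_) S)) ≡⟨ cong₂ (λ xs ys → ∑ xs + ∑ ys) (map-∘ S) (map-∘ S) ⟨
    subsetSum (G ∘ (inside ∷_)) + subsetSum (G ∘ (outside ∷_))  ∎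
    where S = allSubsets n

  subsetSum-pairing : ∀ {n} (m : Fin n) (G : Subset n → Carrier)
                    → (∀ J → m ∉ J → G (J ∪ ⁅ m ⁆) + G J ≈ 0#) → subsetSum G ≈ 0#
  subsetSum-pairing {suc n} zero G pair = begin
    subsetSum G                                                ≈⟨ subsetSum-∷ G ⟩
    subsetSum (G ∘ (inside ∷_)) + subsetSum (G ∘ (outside ∷_)) ≈⟨ ∑-map-+ (G ∘ (inside ∷_)) (G ∘ (outside ∷_)) S ⟨
    ∑ (map (λ J → G (inside ∷ J) + G (outside ∷ J)) S)         ≈⟨ ∑-map-0 S pair-at-zero ⟩
    0#                                                         ∎
    where
    S = allSubsets n
    pair-at-zero : ∀ J → G (inside ∷ J) + G (outside ∷ J) ≈ 0#
    pair-at-zero J = trans (+-congʳ (reflexive (cong (G ∘ (inside ∷_)) (≡.sym (∪-identityʳ J)))))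
                           (pair (outside ∷ J) λ ())
  subsetSum-pairing {suc n} (suc m) G pair = begin
    subsetSum G                                                ≈⟨ subsetSum-∷ G ⟩
    subsetSum (G ∘ (inside ∷_)) + subsetSum (G ∘ (outside ∷_)) ≈⟨ +-cong (half inside) (half outside) ⟩
    0# + 0#                                                    ≈⟨ +-identityˡ 0# ⟩
    0#                                                         ∎
    where
    half : ∀ s → subsetSum (G ∘ (s ∷_)) ≈ 0#
    half inside  = subsetSum-pairing m (G ∘ (inside ∷_))  λ J m∉J → pair (inside ∷ J)  (m∉J ∘ drop-there)
    half outside = subsetSum-pairing m (G ∘ (outside ∷_)) λ J m∉J → pair (outside ∷ J) (m∉J ∘ drop-there)

  subsetSum-nonempty : ∀ {n} (G : Subset n → Carrier)
                     → subsetSum (λ J → if does (nonempty? J) then G J else 0#) + G ⊥ ≈ subsetSum G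
  subsetSum-nonempty {zero}  G = trans (+-congʳ (+-identityˡ 0#)) (trans (+-identityˡ _) (sym (+-identityʳ _)))
  subsetSum-nonempty {suc n} G = begin
    subsetSum nonemptyPart + G ⊥
      ≈⟨ +-congʳ (subsetSum-∷ nonemptyPart) ⟩
    (subsetSum (nonemptyPart ∘ (inside ∷_)) + subsetSum (nonemptyPart ∘ (outside ∷_))) + G ⊥
      ≡⟨ cong₂ (λ x y → (x + y) + G ⊥)
               (cong ∑ (map-cong (λ J → cong (λ b → if b then G (inside ∷ J) else 0#) (does-nonempty-inside J)) S))
               (cong ∑ (map-cong (λ J → cong (λ b → if b then G (outside ∷ J) else 0#) (does-nonempty-outside J)) S)) ⟩
    (subsetSum (G ∘ (inside ∷_)) + subsetSum (λ J → if does (nonempty? J) then G (outside ∷ J) else 0#)) + G (outside ∷ ⊥)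
      ≈⟨ +-assoc _ _ _ ⟩
    subsetSum (G ∘ (inside ∷_)) + (subsetSum (λ J → if does (nonempty? J) then G (outside ∷ J) else 0#) + G (outside ∷ ⊥))
      ≈⟨ +-congˡ (subsetSum-nonempty (G ∘ (outside ∷_))) ⟩
    subsetSum (G ∘ (inside ∷_)) + subsetSum (G ∘ (outside ∷_))
      ≈⟨ subsetSum-∷ G ⟨
    subsetSum G ∎
    where
    S = allSubsets n
    nonemptyPart : Subset (suc n) → Carrier
    nonemptyPart J = if does (nonempty? J) then G J else 0#

-- The signed terms (-1)^|J| q^E(J) and their vanishing total over J ⊆ I'

module SignedTerms {c ℓ : Level} (R : CommutativeRing c ℓ) (q : CommutativeRing.Carrier R)
                   {n} (a : Fin n → ℕ) (i : Fin n) (I' : Subset n) where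
  open CommutativeRing R hiding (_-_)
  open RingProperties ring using (-1*x≈-x; -‿distribˡ-*)
  open SetoidReasoning setoid
  open Exponent a i I' using (exponent; module LeastElement)
  open SubsetSums R using (subsetSum; subsetSum-pairing)

  term : Subset n → Carrier
  term J = pow R (- 1#) ∣ J ∣ * pow R q (exponent J)

  restricted : Subset n → Carrier
  restricted J = if does (J ⊆? I') then term J else 0#

  restricted-nonempty : ∀ J → (if does (J ⊆? I') ∧ does (nonempty? J) then term J else 0#)
                            ≡ (if does (nonempty? J) then restricted J else 0#)
  restricted-nonempty J with does (J ⊆? I') | does (nonempty? J)
  ... | true  | true  = ≡.refl
  ... | true  | false = ≡.refl
  ... | false | true  = ≡.refl
  ... | false | false = ≡.refl

  restricted-⊥ : restricted ⊥ ≈ pow R q (exponent ⊥)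
  restricted-⊥ = begin
    restricted ⊥                                 ≡⟨ cong (λ b → if b then term ⊥ else 0#) (dec-true (⊥ ⊆? I') ⊥⊆) ⟩
    pow R (- 1#) ∣ ⊥ {n = n} ∣ * pow R q (exponent ⊥) ≡⟨ cong (λ k → pow R (- 1#) k * pow R q (exponent ⊥)) (∣⊥∣≡0 n) ⟩
    1# * pow R q (exponent ⊥)                    ≈⟨ *-identityˡ _ ⟩
    pow R q (exponent ⊥)                         ∎

  sign-cancel : ∀ k x → pow R (- 1#) (suc k) * x + pow R (- 1#) k * x ≈ 0#
  sign-cancel k x = begin
    (- 1# * s) * x + s * x  ≈⟨ +-congʳ (*-congʳ (-1*x≈-x s)) ⟩
    (- s) * x + s * x       ≈⟨ +-congʳ (-‿distribˡ-* s x) ⟨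
    - (s * x) + s * x       ≈⟨ -‿inverseˡ (s * x) ⟩
    0#                      ∎
    where s = pow R (- 1#) k

  module _ (m : Fin n) (m∈I' : m ∈ I') (m≢i : m ≢ i) (m-least : ∀ u → u ∈ I' → toℕ m ≤ toℕ u) where
    open LeastElement m m∈I' m≢i m-least using (exponent-∪⁅m⁆)

    term-pairing : ∀ J → m ∉ J → term (J ∪ ⁅ m ⁆) + term J ≈ 0#
    term-pairing J m∉J = begin
      term (J ∪ ⁅ m ⁆) + term J
        ≡⟨ cong₂ (λ k e → pow R (- 1#) k * pow R q e + term J) (∣J∪⁅m⁆∣ m J m∉J) (exponent-∪⁅m⁆ J m∉J) ⟩
      pow R (- 1#) (suc ∣ J ∣) * pow R q (exponent J) + term J
        ≈⟨ sign-cancel ∣ J ∣ (pow R q (exponent J)) ⟩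
      0# ∎

    restricted-pairing : ∀ J → m ∉ J → restricted (J ∪ ⁅ m ⁆) + restricted J ≈ 0#
    restricted-pairing J m∉J rewrite does-∪⁅⁆⊆ {I' = I'} J m∈I' with does (J ⊆? I')
    ... | true  = term-pairing J m∉J
    ... | false = +-identityˡ 0#

    restricted-sum : subsetSum restricted ≈ 0#
    restricted-sum = subsetSum-pairing m restricted restricted-pairing

lemma5p2 : ∀ {c ℓ} (R : CommutativeRing c ℓ) (q : CommutativeRing.Carrier R)
    (n : ℕ) (a : Fin n → ℕ) → (∀ k → 1 ≤ a k)
    → (I : Subset n) → 2 ≤ ∣ I ∣ → (i : Fin n) → i ∈ I
    → CommutativeRing._≈_ R
        (ringSum R (map (λ J → CommutativeRing._*_ R
                                 (pow R (CommutativeRing.-_ R (CommutativeRing.1# R)) ∣ J ∣)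
                                 (pow R q (Ldel i (I - i) J a +ℕ aS J a)))
                        (filter (λ J → (J ⊆? (I - i)) ×-dec nonempty? J) (allSubsets n))))
        (CommutativeRing.-_ R (pow R q (L I ⁅ i ⁆ a ∸ tailSum i a)))
lemma5p2 R q n a _ I 2≤∣I∣ i i∈I = begin
  ∑ (map term (filter P? (allSubsets n)))
    ≈⟨ ∑-filter P? term (allSubsets n) ⟩
  ∑ (map (λ J → if does (P? J) then term J else 0#) (allSubsets n))
    ≡⟨ cong ∑ (map-cong restricted-nonempty (allSubsets n)) ⟩
  subsetSum (λ J → if does (nonempty? J) then restricted J else 0#)
    ≈⟨ inverseˡ-unique _ _ total ⟩
  - restricted ⊥
    ≈⟨ -‿cong restricted-⊥ ⟩
  - pow R q (exponent ⊥)
    ≡⟨ cong (λ e → - pow R q e) (exponent-⊥ a i I i∈I) ⟩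
  - pow R q (L I ⁅ i ⁆ a ∸ tailSum i a) ∎
  where
  open CommutativeRing R hiding (_-_)
  open GroupProperties +-group using (inverseˡ-unique)
  open SetoidReasoning setoid
  open SubsetSums R using (∑; ∑-filter; subsetSum; subsetSum-nonempty)
  open SignedTerms R q a i (I - i)
  open Exponent a i (I - i) using (exponent)
  open EmptyExponent using (exponent-⊥)

  P? : ∀ J → Dec (J ⊆ I - i × Nonempty J)
  P? J = (J ⊆? (I - i)) ×-dec nonempty? J

  total : subsetSum (λ J → if does (nonempty? J) then restricted J else 0#) + restricted ⊥ ≈ 0#
  total with least (I - i) (nonempty-minus I i 2≤∣I∣)
  ... | m , m∈I' , m-least = trans (subsetSum-nonempty restricted) (restricted-sum m m∈I' (x∈p-y⇒x≢y I m∈I') m-least)
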